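{- Let $n\ge2$. The complete graph $K_n$ is not strong $k$-cop-win for any $1\le k\le\lceil n/2\rceil-1$, and it is strong $\lceil n/2\rceil$-cop-win. Moreover, $\lim_{m\to\infty}\operatorname{capt}_{\lceil n/2\rceil}(K_n,m)=1$.
   Context: All graphs are reflexive. The game of $k$ cops and $m$ robbers: in round $0$ the cops choose starting vertices, then the robbers choose starting vertices (players may share vertices). In each round $i\ge1$ every cop moves to an adjacent vertex or stays, then every robber moves to an adjacent vertex or stays. Whenever a cop occupies the same vertex as some robbers, those robbers are captured and leave the game. For a $k$-cop-win graph $G$, $\operatorname{capt}_k(G,m)$ is the smallest $t$ such that the $k$ cops have a strategy guaranteeing all $m$ robbers are captured by round $t$ regardless of the robbers' play. $G$ is strong $k$-cop-win if $\lim_{m\to\infty}\operatorname{capt}_k(G,m)$ exists (is finite). -}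

module Defs where

open import Data.Nat using (ℕ; zero; suc; _≤_; _<_)
open import Data.Fin using (Fin; _≟_)
open import Data.Vec using (Vec; map)
open import Data.Vec.Relation.Unary.Any using (any?)
open import Data.Vec.Relation.Unary.All using (All)
open import Data.Vec.Relation.Binary.Pointwise.Inductive using (Pointwise)
open import Data.Maybe using (Maybe; just; nothing)
open import Data.Bool using (if_then_else_)
open import Data.Product using (Σ; ∃; _×_)
open import Data.Sum using (_⊎_)
open import Data.Unit using (⊤)
open import Relation.Nullary using (¬_; does)
open import Relation.Binary.PropositionalEquality using (_≡_)

-- Adj u v means "u and v are adjacent"; reflexivity means Adj v v,
-- so "move to an adjacent vertex or stay" is exactly "move along Adj".
record Graph : Set₁ where
  field
    n        : ℕ
    Adj      : Fin n → Fin n → Set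
    adj-refl : ∀ v → Adj v v
    adj-sym  : ∀ {u v} → Adj u v → Adj v u

open Graph public

K : ℕ → Graph
K n = record { n = n ; Adj = λ _ _ → ⊤ ; adj-refl = λ _ → _ ; adj-sym = λ _ → _ }

module Game (G : Graph) where
  V : Set
  V = Fin (n G)

  -- Robber state: just v = active at v; nothing = captured (left the game).
  -- Remove every active robber that shares a vertex with some cop.
  capture : ∀ {k} → Vec V k → Maybe V → Maybe V
  capture C nothing  = nothing
  capture C (just v) = if does (any? (_≟ v) C) then nothing else just v

  captureAll : ∀ {k m} → Vec V k → Vec (Maybe V) m → Vec (Maybe V) m
  captureAll C R = map (capture C) R

  CopMove : ∀ {k} → Vec V k → Vec V k → Set
  CopMove = Pointwise (Adj G)

  data RStep : Maybe V → Maybe V → Set where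
    gone : RStep nothing nothing
    step : ∀ {u v} → Adj G u v → RStep (just u) (just v)

  RobMove : ∀ {m} → Vec (Maybe V) m → Vec (Maybe V) m → Set
  RobMove = Pointwise RStep

  AllCaptured : ∀ {m} → Vec (Maybe V) m → Set
  AllCaptured = All (_≡ nothing)

  -- Win t C R: from the position reached at the end of a round
  -- (cops at C, robbers R, captures already resolved), the cops can
  -- force that all robbers are captured within t further rounds.
  Win : ∀ {k m} → ℕ → Vec V k → Vec (Maybe V) m → Set
  Win zero    C R = AllCaptured R
  Win (suc t) C R =
    AllCaptured R ⊎
    Σ (Vec V _) λ C' → CopMove C C' ×
      (∀ R' → RobMove (captureAll C' R) R' → Win t C' (captureAll C' R'))

  -- capt_k(G,m) ≤ t : k cops can guarantee capture of all m robbers by round t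
  -- (round 0: cops place, then robbers place).
  CaptBy : ℕ → ℕ → ℕ → Set
  CaptBy k m t =
    Σ (Vec V k) λ C₀ → ∀ (R₀ : Vec V m) → Win t C₀ (captureAll C₀ (map just R₀))

  IsCapt : ℕ → ℕ → ℕ → Set
  IsCapt k m t = CaptBy k m t × (∀ s → s < t → ¬ CaptBy k m s)

  CopWin : ℕ → Set
  CopWin k = ∃ λ t → CaptBy k 1 t

  -- lim_{m→∞} capt_k(G,m) = L  (the ℕ-valued sequence is eventually L)
  CaptLimit : ℕ → ℕ → Set
  CaptLimit k L = ∃ λ M → ∀ m → M ≤ m → IsCapt k m L

  StrongCopWin : ℕ → Set
  StrongCopWin k = CopWin k × ∃ λ L → CaptLimit k L

open Game public

-- A cop of K_n can jump to any vertex.  Hence ⌈n/2⌉ cops starting on one half of the vertices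
-- and moving onto the other half catch every robber by round 1, and not by round 0 since
-- ⌈n/2⌉ < n.  Against k cops with 2k+1 ≤ n, the robbers keep, with t rounds to go, squads of
-- (k+1)^t robbers on k+1 distinct vertices.  The cops' move lands on at most k of them; a surviving
-- squad splits into k+1 squads of (k+1)^(t-1) on k+1 vertices free of cops, while all other robbers
-- stay put.  So (k+1)^(t+1) robbers survive t rounds, and capt_k(K_n, m) is unbounded in m.

{-# OPTIONS --safe #-}
module Submission where

open import Defs
open import Data.Nat
  using (ℕ; zero; suc; _+_; _*_; _^_; _∸_; _≤_; _<_; s≤s; s≤s⁻¹; NonZero; ⌊_/2⌋; ⌈_/2⌉)
open import Data.Nat.Properties
  using (module ≤-Reasoning; ≤-trans; <⇒≱; n<1+n; m≤m+n; +-suc; +-mono-≤; +-monoˡ-≤; +-monoʳ-≤;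
         m+n≤o⇒m≤o; m^n>0; ⌊n/2⌋≤⌈n/2⌉; ⌊n/2⌋+⌈n/2⌉≡n; ⌈n/2⌉<n)
open import Data.Nat.DivMod using (_mod_; m<n⇒m%n≡m)
open import Data.Fin using (Fin; zero; suc; toℕ; inject≤; _≟_)
open import Data.Fin.Properties
  using (toℕ-injective; toℕ-fromℕ<; toℕ-inject≤; toℕ<n; ¬∀⟶∃¬; injective⇒≤)
open import Data.Vec using (Vec; []; _∷_; _++_; replicate; map; tabulate; lookup; splitAt)
open import Data.Vec.Properties using (map-replicate)
import Data.Vec.Functional as Vector
open import Data.Vec.Membership.Propositional.Properties using (∈-tabulate⁺)
open import Data.Vec.Relation.Unary.Any as Any using (Any; here; there; any?; index)
open import Data.Vec.Relation.Unary.Any.Properties using (lookup-index; ++⁻)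
open import Data.Vec.Relation.Unary.All as All using (All; []; _∷_)
import Data.Vec.Relation.Unary.All.Properties as All
open import Data.Vec.Relation.Binary.Pointwise.Inductive using (Pointwise; []; _∷_)
open import Data.Maybe using (Maybe; just; nothing)
open import Data.Product using (Σ; ∃; ∃₂; _×_; _,_; proj₁)
open import Data.Sum using (_⊎_; inj₁; inj₂)
open import Data.Unit using (tt)
open import Data.Empty using (⊥-elim)
open import Function using (_∘_; id)
open import Function.Definitions using (Injective)
open import Relation.Binary.Definitions using (Reflexive)
open import Relation.Nullary using (¬_; yes; no)
open import Relation.Binary.PropositionalEquality
  using (_≡_; refl; sym; trans; cong; subst; module ≡-Reasoning)

private variable
  A B : Set
  a b c j k m p : ℕ
  xs xs′ : Vec A a
  ys : Vec A b
  zs : Vec A c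

infix 4 _⊑_

data _⊑_ {A : Set} : ∀ {a b} → Vec A a → Vec A b → Set where
  []   : [] ⊑ []
  keep : ∀ {x} → xs ⊑ ys → x ∷ xs ⊑ x ∷ ys
  skip : ∀ {y} → xs ⊑ ys → xs ⊑ y ∷ ys

⊑-refl : (xs : Vec A a) → xs ⊑ xs
⊑-refl []       = []
⊑-refl (x ∷ xs) = keep (⊑-refl xs)

⊑-trans : xs ⊑ ys → ys ⊑ zs → xs ⊑ zs
⊑-trans p        (skip q) = skip (⊑-trans p q)
⊑-trans (keep p) (keep q) = keep (⊑-trans p q)
⊑-trans (skip p) (keep q) = skip (⊑-trans p q)
⊑-trans []       []       = []

minimum : (ys : Vec A b) → [] ⊑ ys
minimum []       = []
minimum (y ∷ ys) = skip (minimum ys)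

xs⊑xs++ys : (xs : Vec A a) (ys : Vec A b) → xs ⊑ xs ++ ys
xs⊑xs++ys []       ys = minimum ys
xs⊑xs++ys (x ∷ xs) ys = keep (xs⊑xs++ys xs ys)

xs⊑ys++xs : (xs : Vec A a) (ys : Vec A b) → xs ⊑ ys ++ xs
xs⊑ys++xs xs []       = ⊑-refl xs
xs⊑ys++xs xs (y ∷ ys) = skip (xs⊑ys++xs xs ys)

⊑-map⁺ : (f : A → B) → xs ⊑ ys → map f xs ⊑ map f ys
⊑-map⁺ f []       = []
⊑-map⁺ f (keep s) = keep (⊑-map⁺ f s)
⊑-map⁺ f (skip s) = skip (⊑-map⁺ f s)

All-resp-⊑ : {P : A → Set} → xs ⊑ ys → All P ys → All P xs
All-resp-⊑ []       []         = []
All-resp-⊑ (keep s) (px ∷ pys) = px ∷ All-resp-⊑ s pys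
All-resp-⊑ (skip s) (_ ∷ pys)  = All-resp-⊑ s pys

⊑-map-fixed : (f : A → A) → All (λ x → f x ≡ x) xs → xs ⊑ ys → xs ⊑ map f ys
⊑-map-fixed f []             []               = []
⊑-map-fixed f fixed          (skip s)         = skip (⊑-map-fixed f fixed s)
⊑-map-fixed f (fx≡x ∷ fixed) (keep {x = x} s) =
  subst (λ y → x ∷ _ ⊑ y ∷ _) (sym fx≡x) (keep (⊑-map-fixed f fixed s))

⊑-Pointwise-extend : {_∼_ : A → A → Set} {ys : Vec A b} → Reflexive _∼_ →
  xs ⊑ ys → Pointwise _∼_ xs xs′ → Σ (Vec A b) λ ys′ → Pointwise _∼_ ys ys′ × xs′ ⊑ ys′
⊑-Pointwise-extend ∼-refl []       []                = [] , [] , []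
⊑-Pointwise-extend ∼-refl (keep s) (x∼x′ ∷ xs∼xs′)
  with ys′ , ys∼ys′ , s′ ← ⊑-Pointwise-extend ∼-refl s xs∼xs′ = _ ∷ ys′ , x∼x′ ∷ ys∼ys′ , keep s′
⊑-Pointwise-extend ∼-refl (skip s) xs∼xs′
  with ys′ , ys∼ys′ , s′ ← ⊑-Pointwise-extend ∼-refl s xs∼xs′ = _ ∷ ys′ , ∼-refl ∷ ys∼ys′ , skip s′

All-replicate : {P : A → Set} {x : A} → P x → All P (replicate p x)
All-replicate {p = zero}  px = []
All-replicate {p = suc p} px = px ∷ All-replicate px

Pointwise-replicate : {_∼_ : A → B → Set} {x : A} {ys : Vec B m} →
  All (x ∼_) ys → Pointwise _∼_ (replicate m x) ys
Pointwise-replicate []           = []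
Pointwise-replicate (x∼y ∷ x∼ys) = x∼y ∷ Pointwise-replicate x∼ys

blocks : (j p : ℕ) → (Fin j → A) → Vec A (j * p)
blocks zero    p g = []
blocks (suc j) p g = replicate p (g zero) ++ blocks j p (g ∘ suc)

replicate⊑blocks : (g : Fin j → A) (c : Fin j) → replicate p (g c) ⊑ blocks j p g
replicate⊑blocks {p = p} g zero    = xs⊑xs++ys (replicate p (g zero)) _
replicate⊑blocks {p = p} g (suc c) =
  ⊑-trans (replicate⊑blocks (g ∘ suc) c) (xs⊑ys++xs _ (replicate p (g zero)))

All-blocks : {P : A → Set} {g : Fin j → A} → (∀ c → P (g c)) → All P (blocks j p g)
All-blocks {j = zero}  Pg = []
All-blocks {j = suc j} Pg = All.++⁺ (All-replicate (Pg zero)) (All-blocks (Pg ∘ suc))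

Squads : ℕ → (Fin j → A) → Vec (Maybe A) m → Set
Squads p g R = ∀ c → replicate p (just (g c)) ⊑ R

Occupied : Vec A k → A → Set
Occupied C v = Any (_≡ v) C

module _ {n : ℕ} where
  some-unoccupied : {g : Fin j → Fin n} → Injective _≡_ _≡_ g → k < j → (C : Vec (Fin n) k) →
    ∃ λ c → ¬ Occupied C (g c)
  some-unoccupied {j = j} {g = g} g-inj k<j C =
    ¬∀⟶∃¬ j _ (λ c → any? (_≟ g c) C) λ occ → <⇒≱ k<j (injective⇒≤ (occupier-injective occ))
    where
    open ≡-Reasoning
    occupier-injective : (occ : ∀ c → Occupied C (g c)) → Injective _≡_ _≡_ (λ c → index (occ c))
    occupier-injective occ {c} {c′} same-index = g-inj (begin
      g c                        ≡⟨ sym (lookup-index (occ c)) ⟩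
      lookup C (index (occ c))   ≡⟨ cong (lookup C) same-index ⟩
      lookup C (index (occ c′))  ≡⟨ lookup-index (occ c′) ⟩
      g c′                       ∎)

  fresh-injection : ∀ j → k + j ≤ n → (C : Vec (Fin n) k) →
    Σ (Fin j → Fin n) λ w → Injective _≡_ _≡_ w × (∀ c → ¬ Occupied C (w c))
  fresh-injection zero    _ C = (λ ()) , (λ { {()} }) , λ ()
  fresh-injection {k = k} (suc j) k+1+j≤n C
    with 1+k+j≤n ← subst (_≤ n) (+-suc k j) k+1+j≤n
    with v , v∉C ← some-unoccupied id (m+n≤o⇒m≤o (suc k) 1+k+j≤n) C
    with w , w-inj , w∉v∷C ← fresh-injection j 1+k+j≤n (v ∷ C)
    = v Vector.∷ w , v∷w-inj , v∷w∉C
    where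
    v∷w-inj : Injective _≡_ _≡_ (v Vector.∷ w)
    v∷w-inj {zero}  {zero}   _    = refl
    v∷w-inj {zero}  {suc c}  v≡wc = ⊥-elim (w∉v∷C c (here v≡wc))
    v∷w-inj {suc c} {zero}   wc≡v = ⊥-elim (w∉v∷C c (here (sym wc≡v)))
    v∷w-inj {suc c} {suc c′} eq   = cong suc (w-inj eq)
    v∷w∉C : ∀ c → ¬ Occupied C ((v Vector.∷ w) c)
    v∷w∉C zero    = v∉C
    v∷w∉C (suc c) = w∉v∷C c ∘ there

  toℕ-mod : (v : Fin n) .{{_ : NonZero n}} → toℕ v mod n ≡ v
  toℕ-mod v = toℕ-injective (trans (toℕ-fromℕ< _) (m<n⇒m%n≡m (toℕ<n v)))

  tabulate-mod-covers : ∀ {N} → n ≤ N → .{{_ : NonZero n}} →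
    ∀ v → Occupied (tabulate {n = N} (λ x → toℕ x mod n)) v
  tabulate-mod-covers n≤N v =
    subst (Occupied _) (trans (cong (_mod n) (toℕ-inject≤ v n≤N)) (toℕ-mod v))
      (Any.map sym (∈-tabulate⁺ _ (inject≤ v n≤N)))

  two-vector-cover : ∀ h → n ≤ h + h → .{{_ : NonZero n}} →
    ∃₂ λ (C₀ C₁ : Vec (Fin n) h) → ∀ v → Occupied C₀ v ⊎ Occupied C₁ v
  two-vector-cover h n≤h+h with C₀ , C₁ , P≡C₀++C₁ ← splitAt h (tabulate (λ x → toℕ x mod n)) =
    C₀ , C₁ , λ v → ++⁻ C₀ (subst (λ P → Occupied P v) P≡C₀++C₁ (tabulate-mod-covers n≤h+h v))

module _ (G : Graph) where
  capture-unoccupied : (C : Vec (V G) k) {v : V G} → ¬ Occupied C v → capture G C (just v) ≡ just v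
  capture-unoccupied C {v} v∉C with any? (_≟ v) C
  ... | yes v∈C = ⊥-elim (v∉C v∈C)
  ... | no  _   = refl

  capture-occupied : (C : Vec (V G) k) {v : V G} → Occupied C v → capture G C (just v) ≡ nothing
  capture-occupied C {v} v∈C with any? (_≟ v) C
  ... | yes _   = refl
  ... | no  v∉C = ⊥-elim (v∉C v∈C)

  replicate-survives-capture : (C : Vec (V G) k) {v : V G} {R : Vec (Maybe (V G)) m} →
    ¬ Occupied C v → replicate p (just v) ⊑ R → replicate p (just v) ⊑ captureAll G C R
  replicate-survives-capture C v∉C =
    ⊑-map-fixed (capture G C) (All-replicate (capture-unoccupied C v∉C))

  squads-¬AllCaptured : {g : Fin (suc j) → V G} {R : Vec (Maybe (V G)) m} →
    0 < p → Squads p g R → ¬ AllCaptured G R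
  squads-¬AllCaptured {p = suc p} _ squads caught with All-resp-⊑ (squads zero) caught
  ... | () ∷ _

  RStep-refl : Reflexive (RStep G)
  RStep-refl {nothing} = gone
  RStep-refl {just v}  = step (adj-refl G v)

  replicate-RobMove-blocks : {u : V G} {w : Fin j → V G} → (∀ c → Adj G u (w c)) →
    RobMove G (replicate (j * p) (just u)) (blocks j p (just ∘ w))
  replicate-RobMove-blocks u~w = Pointwise-replicate (All-blocks (step ∘ u~w))

  placement-squads : (C : Vec (V G) k) {w : Fin j → V G} → (∀ c → ¬ Occupied C (w c)) →
    (pad : Vec (V G) m) → Squads p w (captureAll G C (map just (pad ++ blocks j p w)))
  placement-squads {p = p} C {w} w∉C pad c =
    replicate-survives-capture C (w∉C c)
      (subst (_⊑ _) (map-replicate just (w c) p)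
        (⊑-map⁺ just (⊑-trans (replicate⊑blocks w c) (xs⊑ys++xs _ pad))))

  RobMove-captured : {R R′ : Vec (Maybe (V G)) m} →
    AllCaptured G R → RobMove G R R′ → AllCaptured G R′
  RobMove-captured []           []             = []
  RobMove-captured (refl ∷ all) (gone ∷ moves) = refl ∷ RobMove-captured all moves

  captureAll-captured : (C : Vec (V G) k) {R : Vec (Maybe (V G)) m} →
    AllCaptured G R → AllCaptured G (captureAll G C R)
  captureAll-captured C = All.map⁺ ∘ All.map λ { refl → refl }

  module _ {C₀ C₁ : Vec (V G) k} (cover : ∀ v → Occupied C₀ v ⊎ Occupied C₁ v) where
    capture-twice-cover : ∀ x → capture G C₁ (capture G C₀ x) ≡ nothing
    capture-twice-cover nothing = refl
    capture-twice-cover (just v) with any? (_≟ v) C₀ | cover v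
    ... | yes _    | _         = refl
    ... | no  v∉C₀ | inj₁ v∈C₀ = ⊥-elim (v∉C₀ v∈C₀)
    ... | no  _    | inj₂ v∈C₁ = capture-occupied C₁ v∈C₁

    captureAll-twice-cover : (R : Vec (Maybe (V G)) m) →
      AllCaptured G (captureAll G C₁ (captureAll G C₀ R))
    captureAll-twice-cover []      = []
    captureAll-twice-cover (x ∷ R) = capture-twice-cover x ∷ captureAll-twice-cover R

    cover⇒captBy-1 : CopMove G C₀ C₁ → ∀ m → CaptBy G k m 1
    cover⇒captBy-1 C₀→C₁ m = C₀ , λ R₀ → inj₂ (C₁ , C₀→C₁ , λ R′ robMove →
      captureAll-captured C₁ (RobMove-captured (captureAll-twice-cover (map just R₀)) robMove))

  ¬captBy-0 : k < n G → 0 < m → ¬ CaptBy G k m 0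
  ¬captBy-0 {m = suc m} k<n _ (C₀ , win) with v , v∉C₀ ← some-unoccupied id k<n C₀
    with capture G C₀ (just v) | capture-unoccupied C₀ v∉C₀ | win (replicate (suc m) v)
  ... | _ | refl | () ∷ _

module _ {n : ℕ} where
  K-CopMove : (C C′ : Vec (Fin n) k) → CopMove (K n) C C′
  K-CopMove []      []       = []
  K-CopMove (_ ∷ C) (_ ∷ C′) = tt ∷ K-CopMove C C′

  K-captBy-1 : ∀ h → n ≤ h + h → .{{_ : NonZero n}} → ∀ m → CaptBy (K n) h m 1
  K-captBy-1 h n≤h+h with C₀ , C₁ , cover ← two-vector-cover h n≤h+h =
    cover⇒captBy-1 (K n) cover (K-CopMove C₀ C₁)

  K-squads-regroup : k + suc k ≤ n → (C : Vec (Fin n) k)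
    {g : Fin (suc k) → Fin n} {R : Vec (Maybe (Fin n)) m} →
    Injective _≡_ _≡_ g → Squads (suc k * p) g R →
    Σ (Vec (Maybe (Fin n)) m) λ R′ → RobMove (K n) (captureAll (K n) C R) R′ ×
      Σ (Fin (suc k) → Fin n) λ w → Injective _≡_ _≡_ w × Squads p w (captureAll (K n) C R′)
  K-squads-regroup {k = k} 2k+1≤n C g-inj squads
    with c , gc∉C ← some-unoccupied g-inj (n<1+n k) C
    with w , w-inj , w∉C ← fresh-injection (suc k) 2k+1≤n C
    with R′ , move , blocks⊑R′ ← ⊑-Pointwise-extend (RStep-refl (K n))
           (replicate-survives-capture (K n) C gc∉C (squads c))
           (replicate-RobMove-blocks (K n) {w = w} (λ _ → tt))
    = R′ , move , w , w-inj , λ c′ → replicate-survives-capture (K n) C (w∉C c′)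
                                       (⊑-trans (replicate⊑blocks (just ∘ w) c′) blocks⊑R′)

  K-squads-evade : k + suc k ≤ n → ∀ t (C : Vec (Fin n) k)
    {g : Fin (suc k) → Fin n} {R : Vec (Maybe (Fin n)) m} →
    Injective _≡_ _≡_ g → Squads (suc k ^ t) g R → ¬ Win (K n) t C R
  K-squads-evade {k = k} _ zero C _ squads caught =
    squads-¬AllCaptured (K n) (m^n>0 (suc k) 0) squads caught
  K-squads-evade {k = k} _ (suc t) C _ squads (inj₁ caught) =
    squads-¬AllCaptured (K n) (m^n>0 (suc k) (suc t)) squads caught
  K-squads-evade 2k+1≤n (suc t) C g-inj squads (inj₂ (C′ , _ , win))
    with R′ , move , w , w-inj , squads′ ← K-squads-regroup 2k+1≤n C′ g-inj squads
    = K-squads-evade 2k+1≤n t C′ w-inj squads′ (win R′ move)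

  K-¬captBy : k + suc k ≤ n → ∀ t M → ¬ CaptBy (K n) k (M + suc k ^ suc t) t
  K-¬captBy {k = k} 2k+1≤n t M (C₀ , win)
    with w , w-inj , w∉C₀ ← fresh-injection (suc k) 2k+1≤n C₀
    = K-squads-evade 2k+1≤n t C₀ w-inj (placement-squads (K n) C₀ w∉C₀ pad)
        (win (pad ++ blocks (suc k) (suc k ^ t) w))
    where
    pad : Vec (Fin n) M
    pad = replicate M (w zero)

  K-¬strongCopWin : k + suc k ≤ n → ¬ StrongCopWin (K n) k
  K-¬strongCopWin 2k+1≤n (_ , L , M , limit) =
    K-¬captBy 2k+1≤n L M (proj₁ (limit _ (m≤m+n M _)))

module _ (n : ℕ) where
  open ≤-Reasoning

  n≤⌈n/2⌉+⌈n/2⌉ : n ≤ ⌈ n /2⌉ + ⌈ n /2⌉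
  n≤⌈n/2⌉+⌈n/2⌉ = begin
    n                  ≡⟨ ⌊n/2⌋+⌈n/2⌉≡n n ⟨
    ⌊ n /2⌋ + ⌈ n /2⌉  ≤⟨ +-monoˡ-≤ ⌈ n /2⌉ (⌊n/2⌋≤⌈n/2⌉ n) ⟩
    ⌈ n /2⌉ + ⌈ n /2⌉  ∎

  ⌈n/2⌉+⌈n/2⌉≤1+n : ⌈ n /2⌉ + ⌈ n /2⌉ ≤ suc n
  ⌈n/2⌉+⌈n/2⌉≤1+n = begin
    ⌈ n /2⌉ + ⌈ n /2⌉          ≤⟨ +-monoʳ-≤ ⌈ n /2⌉ (⌊n/2⌋≤⌈n/2⌉ (suc n)) ⟩
    ⌊ suc n /2⌋ + ⌈ suc n /2⌉  ≡⟨ ⌊n/2⌋+⌈n/2⌉≡n (suc n) ⟩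
    suc n                      ∎

  k<⌈n/2⌉⇒k+1+k≤n : ∀ {k} → k < ⌈ n /2⌉ → k + suc k ≤ n
  k<⌈n/2⌉⇒k+1+k≤n k<⌈n/2⌉ = s≤s⁻¹ (≤-trans (+-mono-≤ k<⌈n/2⌉ k<⌈n/2⌉) ⌈n/2⌉+⌈n/2⌉≤1+n)

proposition4p8 : ∀ (n : ℕ) → 2 ≤ n →
    (∀ k → 1 ≤ k → k ≤ ⌈ n /2⌉ ∸ 1 → ¬ StrongCopWin (K n) k)
    × StrongCopWin (K n) ⌈ n /2⌉
    × CaptLimit (K n) ⌈ n /2⌉ 1
proposition4p8 n@(suc (suc n′)) (s≤s (s≤s _)) =
  too-few-cops , ((1 , one-round 1) , 1 , 1 , limit) , 1 , limit
  where
  too-few-cops : ∀ k → 1 ≤ k → k ≤ ⌈ n /2⌉ ∸ 1 → ¬ StrongCopWin (K n) k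
  too-few-cops k _ k≤⌈n/2⌉-1 = K-¬strongCopWin (k<⌈n/2⌉⇒k+1+k≤n n (s≤s k≤⌈n/2⌉-1))

  one-round : ∀ m → CaptBy (K n) ⌈ n /2⌉ m 1
  one-round = K-captBy-1 ⌈ n /2⌉ (n≤⌈n/2⌉+⌈n/2⌉ n)

  limit : ∀ m → 1 ≤ m → IsCapt (K n) ⌈ n /2⌉ m 1
  limit m 1≤m = one-round m , λ { zero _ → ¬captBy-0 (K n) (⌈n/2⌉<n n′) 1≤m ; (suc _) (s≤s ()) }
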